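{- Let $n\ge1$ and let $G$ be the hypertree $HT(n)$. Then every minimum locating-total dominating set of $G$ contains at least $3\cdot 2^{n-2}$ vertices from levels $n-1$ and $n$.
   Context: The hypertree $HT(n)$ has vertex set $\{1,\dots,2^{n+1}-1\}$, with the complete binary tree edges $\{x,2x\},\{x,2x+1\}$ (the root $1$ is at level $0$; vertex $v$ is at level $i$ iff $2^i\le v\le 2^{i+1}-1$) plus, for each level $i\ge1$, edges between level-$i$ vertices whose labels differ by $2^{i-1}$. A locating-total dominating set is a set $S$ such that every vertex of $G$ has a neighbor in $S$ and distinct $u,v\notin S$ satisfy $N(u)\cap S\ne N(v)\cap S$ (open neighborhoods); a minimum one is one of least cardinality. -}

module Defs where

open import Data.Nat using (ℕ; _+_; _*_; _∸_; _^_; _≤_; _<_; _≤?_)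
open import Data.Product using (_×_; Σ; ∃; _,_)
open import Data.Sum using (_⊎_)
open import Data.List using (List; length; filter)
open import Data.List.Membership.Propositional using (_∈_; _∉_)
open import Data.List.Relation.Unary.All using (All)
open import Data.List.Relation.Unary.Unique.Propositional using (Unique)
open import Relation.Binary.PropositionalEquality using (_≡_; _≢_)
open import Relation.Nullary using (¬_)
open import Function.Bundles using (_⇔_)

Vertex : ℕ → ℕ → Set
Vertex n v = 1 ≤ v × v < 2 ^ (n + 1)

AtLevel : ℕ → ℕ → Set
AtLevel i v = 2 ^ i ≤ v × v < 2 ^ (i + 1)

TreeEdge : ℕ → ℕ → Set
TreeEdge x y = y ≡ 2 * x ⊎ y ≡ 2 * x + 1

LevelEdge : ℕ → ℕ → Set
LevelEdge u v = Σ ℕ λ i → 1 ≤ i × AtLevel i u × AtLevel i v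
                  × (v ≡ u + 2 ^ (i ∸ 1) ⊎ u ≡ v + 2 ^ (i ∸ 1))

Adj : ℕ → ℕ → ℕ → Set
Adj n u v = Vertex n u × Vertex n v
            × (TreeEdge u v ⊎ TreeEdge v u ⊎ LevelEdge u v)

IsVertexSet : ℕ → List ℕ → Set
IsVertexSet n S = Unique S × All (Vertex n) S

TotalDominating : ℕ → List ℕ → Set
TotalDominating n S = ∀ v → Vertex n v → ∃ λ s → s ∈ S × Adj n v s

Locating : ℕ → List ℕ → Set
Locating n S = ∀ u v → Vertex n u → Vertex n v → u ≢ v → u ∉ S → v ∉ S →
               ¬ (∀ s → s ∈ S → (Adj n u s ⇔ Adj n v s))

IsLTDS : ℕ → List ℕ → Set
IsLTDS n S = IsVertexSet n S × TotalDominating n S × Locating n S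

IsMinLTDS : ℕ → List ℕ → Set
IsMinLTDS n S = IsLTDS n S × (∀ T → IsLTDS n T → length S ≤ length T)

-- Number of elements of S in levels n-1 and n (for vertices of HT(n), n ≥ 1,
-- these are exactly the labels v with 2^(n-1) ≤ v).
countLastTwo : ℕ → List ℕ → ℕ
countLastTwo n S = length (filter (λ v → 2 ^ (n ∸ 1) ≤? v) S)

module Submission where

open import Defs
open import Data.Nat using (ℕ; _*_; _^_; _≤_)
open import Data.List using (List)

open import Data.Nat using (zero; suc; _+_; _∸_; _<_; _≤?_; z≤n; s≤s; _≟_)
open import Data.Nat.Properties
open import Data.Nat.Tactic.RingSolver using (solve-∀)
open import Algebra.Properties.CommutativeSemigroup +-commutativeSemigroup using (interchange)
open import Data.Product using (Σ; _×_; _,_; proj₁; proj₂)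
open import Data.Sum using (_⊎_; inj₁; inj₂)
open import Data.Empty using (⊥-elim)
open import Data.List using ([]; _∷_; filter; length)
open import Data.List.Membership.Propositional using (_∈_; _∉_)
open import Data.List.Membership.Propositional.Properties using (∈-filter⁺; ∈-filter⁻)
open import Data.List.Membership.DecPropositional _≟_ using (_∈?_)
open import Data.List.Relation.Binary.Subset.Propositional using (_⊆_)
open import Data.List.Relation.Unary.Any using (here; there)
import Data.List.Relation.Unary.All as All
import Data.List.Relation.Unary.AllPairs as AllPairs
open import Data.List.Relation.Unary.Unique.Propositional using (Unique)
open import Data.List.Relation.Unary.Unique.Propositional.Properties using (filter⁺)
open import Relation.Binary.PropositionalEquality
open import Relation.Binary.Definitions using (tri<; tri≈; tri>)
open import Relation.Nullary using (¬_; Dec; yes; no)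
open import Function.Bundles using (_⇔_; mk⇔)

-- Write n = m + 2 and h = 2^m, so level n-1 is [2h, 4h) and
-- level n is [4h, 8h).  Pair each x in [2h, 3h) with its level partner
-- x' = x + h.  The children a = 2x, b = 2x+1 of x and a' = 2x', b' = 2x'+1
-- of x' are leaves, and each leaf is adjacent only to its parent and to its
-- twin (a ~ a', b ~ b').  In such a "twin configuration" every
-- locating-total dominating set S contains at least three of the six
-- vertices x, x', a, b, a', b': total domination forces leaves into S when a
-- parent is missing, and if both parents are in S but no leaf is, then a and
-- b would both see exactly {x} in S, violating location.  The h
-- configurations partition levels n-1 and n, so S has at least 3h = 3·2^(n-2)
-- vertices there.  For n = 1 the last two levels are all of HT(1), and any
-- total dominating set has two adjacent, hence distinct, members.

delete : ∀ {x : ℕ} {T : List ℕ} → x ∈ T →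
         Σ (List ℕ) λ T' → length T ≡ suc (length T') × (∀ {y} → y ∈ T → y ≢ x → y ∈ T')
delete {T = t ∷ T} (here refl) = T , refl , keep
  where
  keep : ∀ {y} → y ∈ t ∷ T → y ≢ t → y ∈ T
  keep (here refl) y≢t = ⊥-elim (y≢t refl)
  keep (there y∈T) _   = y∈T
delete {x} {T = t ∷ T} (there x∈T) with delete x∈T
... | T' , len≡ , keep = t ∷ T' , cong suc len≡ , keep′
  where
  keep′ : ∀ {y} → y ∈ t ∷ T → y ≢ x → y ∈ t ∷ T'
  keep′ (here refl) _    = here refl
  keep′ (there y∈T) y≢x = there (keep y∈T y≢x)

unique⊆⇒length≤ : ∀ {L T : List ℕ} → Unique L → L ⊆ T → length L ≤ length T
unique⊆⇒length≤ {[]}    _ _ = z≤n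
unique⊆⇒length≤ {x ∷ L} (x∉L AllPairs.∷ uniqueL) L⊆T with delete (L⊆T (here refl))
... | T' , len≡ , keep = subst (suc (length L) ≤_) (sym len≡) (s≤s (unique⊆⇒length≤ uniqueL L⊆T'))
  where
  L⊆T' : L ⊆ T'
  L⊆T' y∈L = keep (L⊆T (there y∈L)) (λ y≡x → All.lookup x∉L y∈L (sym y≡x))

interval : ℕ → ℕ → List ℕ
interval a zero    = []
interval a (suc m) = a ∷ interval (suc a) m

interval-lower : ∀ a m {y} → y ∈ interval a m → a ≤ y
interval-lower a (suc m) (here refl) = ≤-refl
interval-lower a (suc m) (there y∈) = ≤-trans (n≤1+n a) (interval-lower (suc a) m y∈)

interval-unique : ∀ a m → Unique (interval a m)
interval-unique a zero    = AllPairs.[]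
interval-unique a (suc m) =
  All.tabulate (λ y∈ a≡y → 1+n≰n (subst (suc a ≤_) (sym a≡y) (interval-lower (suc a) m y∈)))
  AllPairs.∷ interval-unique (suc a) m

sumRange : (ℕ → ℕ) → ℕ → ℕ → ℕ
sumRange f a zero    = 0
sumRange f a (suc m) = f a + sumRange f (suc a) m

indicator : List ℕ → ℕ → ℕ
indicator S v with v ∈? S
... | yes _ = 1
... | no _  = 0

indicator-∈ : ∀ {S v} → v ∈ S → 1 ≤ indicator S v
indicator-∈ {S} {v} v∈S with v ∈? S
... | yes _   = ≤-refl
... | no v∉S = ⊥-elim (v∉S v∈S)

sumRange-indicator : ∀ S a m → sumRange (indicator S) a m ≡ length (filter (_∈? S) (interval a m))
sumRange-indicator S a zero = refl
sumRange-indicator S a (suc m) with a ∈? S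
... | yes _ = cong suc (sumRange-indicator S (suc a) m)
... | no _  = sumRange-indicator S (suc a) m

-- The members of S in an interval starting at a are among the members of S
-- that are at least a; the former are distinct, so pigeonhole applies.
sumRange-indicator≤ : ∀ S a m → sumRange (indicator S) a m ≤ length (filter (a ≤?_) S)
sumRange-indicator≤ S a m =
  subst (_≤ length (filter (a ≤?_) S)) (sym (sumRange-indicator S a m))
        (unique⊆⇒length≤ (filter⁺ (_∈? S) (interval-unique a m)) members≥a)
  where
  members≥a : filter (_∈? S) (interval a m) ⊆ filter (a ≤?_) S
  members≥a y∈ with ∈-filter⁻ (_∈? S) y∈
  ... | y∈interval , y∈S = ∈-filter⁺ (a ≤?_) y∈S (interval-lower a m y∈interval)

sumRange-++ : ∀ f a m k → sumRange f a (m + k) ≡ sumRange f a m + sumRange f (a + m) k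
sumRange-++ f a zero    k rewrite +-identityʳ a = refl
sumRange-++ f a (suc m) k rewrite sumRange-++ f (suc a) m k | +-suc a m =
  sym (+-assoc (f a) _ _)

sumRange-shift : ∀ f a t m → sumRange f (a + t) m ≡ sumRange (λ x → f (x + t)) a m
sumRange-shift f a t zero    = refl
sumRange-shift f a t (suc m) = cong (f (a + t) +_) (sumRange-shift f (suc a) t m)

sumRange-+ : ∀ f g a m → sumRange (λ x → f x + g x) a m ≡ sumRange f a m + sumRange g a m
sumRange-+ f g a zero    = refl
sumRange-+ f g a (suc m) rewrite sumRange-+ f g (suc a) m = interchange (f a) (g a) _ _

sumRange-children : ∀ f a m →
  sumRange f (2 * a) (2 * m) ≡ sumRange (λ x → f (2 * x) + f (suc (2 * x))) a m
sumRange-children f a zero    = refl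
sumRange-children f a (suc m) = begin
    sumRange f (2 * a) (2 * suc m)
  ≡⟨ cong (sumRange f (2 * a)) (*-suc 2 m) ⟩
    f (2 * a) + (f (suc (2 * a)) + sumRange f (2 + 2 * a) (2 * m))
  ≡⟨ sym (+-assoc (f (2 * a)) _ _) ⟩
    (f (2 * a) + f (suc (2 * a))) + sumRange f (2 + 2 * a) (2 * m)
  ≡⟨ cong (λ b → (f (2 * a) + f (suc (2 * a))) + sumRange f b (2 * m)) (sym (*-suc 2 a)) ⟩
    (f (2 * a) + f (suc (2 * a))) + sumRange f (2 * suc a) (2 * m)
  ≡⟨ cong (_ +_) (sumRange-children f (suc a) m) ⟩
    (f (2 * a) + f (suc (2 * a))) + sumRange (λ x → f (2 * x) + f (suc (2 * x))) (suc a) m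
  ∎
  where open ≡-Reasoning

sumRange-lower : ∀ f b a m → (∀ x → a ≤ x → x < a + m → b ≤ f x) → m * b ≤ sumRange f a m
sumRange-lower f b a zero    _     = z≤n
sumRange-lower f b a (suc m) bound =
  +-mono-≤ (bound a ≤-refl (m<m+n a (s≤s z≤n)))
           (sumRange-lower f b (suc a) m λ x a<x x<end →
              bound x (<⇒≤ a<x) (subst (x <_) (sym (+-suc a m)) x<end))

sumRange-fold : ∀ f a h → sumRange f a (2 * h) ≡ sumRange (λ x → f x + f (x + h)) a h
sumRange-fold f a h = begin
    sumRange f a (2 * h)
  ≡⟨ cong (λ k → sumRange f a (h + k)) (+-identityʳ h) ⟩
    sumRange f a (h + h)
  ≡⟨ sumRange-++ f a h h ⟩
    sumRange f a h + sumRange f (a + h) h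
  ≡⟨ cong (sumRange f a h +_) (sumRange-shift f a h h) ⟩
    sumRange f a h + sumRange (λ x → f (x + h)) a h
  ≡⟨ sym (sumRange-+ f (λ x → f (x + h)) a h) ⟩
    sumRange (λ x → f x + f (x + h)) a h
  ∎
  where open ≡-Reasoning

family : (ℕ → ℕ) → ℕ → ℕ
family f x = f x + (f (2 * x) + f (suc (2 * x)))

sumRange-families : ∀ f Q → sumRange f Q (Q + 2 * Q) ≡ sumRange (family f) Q Q
sumRange-families f Q = begin
    sumRange f Q (Q + 2 * Q)
  ≡⟨ sumRange-++ f Q Q (2 * Q) ⟩
    sumRange f Q Q + sumRange f (Q + Q) (2 * Q)
  ≡⟨ cong (λ k → sumRange f Q Q + sumRange f (Q + k) (2 * Q)) (sym (+-identityʳ Q)) ⟩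
    sumRange f Q Q + sumRange f (2 * Q) (2 * Q)
  ≡⟨ cong (sumRange f Q Q +_) (sumRange-children f Q Q) ⟩
    sumRange f Q Q + sumRange (λ x → f (2 * x) + f (suc (2 * x))) Q Q
  ≡⟨ sym (sumRange-+ f _ Q Q) ⟩
    sumRange (family f) Q Q
  ∎
  where open ≡-Reasoning

pow-suc : ∀ n → 2 ^ (n + 1) ≡ 2 * 2 ^ n
pow-suc n = cong (2 ^_) (+-comm n 1)

pow-pos : ∀ n → 1 ≤ 2 ^ n
pow-pos n = m^n>0 2 n

four-quarters : ∀ q → 2 * (2 * q) ≡ 2 * q + q + q
four-quarters = solve-∀

root-vertex : ∀ n → Vertex n 1
root-vertex n = ≤-refl , subst (1 <_) (sym (pow-suc n)) (*-monoʳ-≤ 2 (pow-pos n))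

level⇒vertex : ∀ n {v} → AtLevel n v → Vertex n v
level⇒vertex n (lower , upper) = ≤-trans (pow-pos n) lower , upper

level-unique : ∀ {i j v} → AtLevel i v → AtLevel j v → i ≡ j
level-unique {i} {j} {v} (lowerᵢ , upperᵢ) (lowerⱼ , upperⱼ) with <-cmp i j
... | tri≈ _ i≡j _ = i≡j
... | tri< i<j _ _ =
  ⊥-elim (<⇒≱ (subst (v <_) (pow-suc i) upperᵢ) (≤-trans (^-monoʳ-≤ 2 i<j) lowerⱼ))
... | tri> _ _ j<i =
  ⊥-elim (<⇒≱ (subst (v <_) (pow-suc j) upperⱼ) (≤-trans (^-monoʳ-≤ 2 j<i) lowerᵢ))

adj-irreflexive : ∀ {n u} → ¬ Adj n u u
adj-irreflexive {u = u} (u-vertex , _ , edge) = no-loop edge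
  where
  no-tree-loop : ¬ TreeEdge u u
  no-tree-loop (inj₁ u≡2u) =
    <-irrefl u≡2u (m<m+n u (≤-trans (proj₁ u-vertex) (m≤m+n u 0)))
  no-tree-loop (inj₂ u≡2u+1) =
    <-irrefl u≡2u+1 (≤-<-trans (m≤m+n u (u + 0)) (m<m+n (2 * u) (s≤s z≤n)))
  no-loop : ¬ (TreeEdge u u ⊎ TreeEdge u u ⊎ LevelEdge u u)
  no-loop (inj₁ tree)        = no-tree-loop tree
  no-loop (inj₂ (inj₁ tree)) = no-tree-loop tree
  no-loop (inj₂ (inj₂ (i , _ , _ , _ , inj₁ u≡))) = <-irrefl u≡ (m<m+n u (pow-pos (i ∸ 1)))
  no-loop (inj₂ (inj₂ (i , _ , _ , _ , inj₂ u≡))) = <-irrefl u≡ (m<m+n u (pow-pos (i ∸ 1)))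

bottom-childless : ∀ n {v s} → AtLevel n v → Vertex n s → ¬ TreeEdge v s
bottom-childless n {v} {s} (lower , _) (_ , s<top) edge =
  <⇒≱ (subst (s <_) (pow-suc n) s<top) (child-large edge)
  where
  child-large : TreeEdge v s → 2 * 2 ^ n ≤ s
  child-large (inj₁ s≡) = subst (2 * 2 ^ n ≤_) (sym s≡) (*-monoʳ-≤ 2 lower)
  child-large (inj₂ s≡) =
    subst (2 * 2 ^ n ≤_) (sym s≡) (≤-trans (*-monoʳ-≤ 2 lower) (m≤m+n (2 * v) 1))

leaf-nbrs : ∀ n {v s} → AtLevel n v → Adj n v s →
            TreeEdge s v ⊎ (AtLevel n s × (s ≡ v + 2 ^ (n ∸ 1) ⊎ v ≡ s + 2 ^ (n ∸ 1)))
leaf-nbrs n lv (_ , s-vertex , inj₁ down) = ⊥-elim (bottom-childless n lv s-vertex down)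
leaf-nbrs n lv (_ , _ , inj₂ (inj₁ up)) = inj₁ up
leaf-nbrs n {v} lv (_ , _ , inj₂ (inj₂ (i , _ , li , ls , twin))) with level-unique {i} {n} {v} li lv
... | refl = inj₂ (ls , twin)

parent-even : ∀ {x s} → TreeEdge s (2 * x) → s ≡ x
parent-even {x} {s} (inj₁ 2x≡2s) = sym (*-cancelˡ-≡ x s 2 2x≡2s)
parent-even {x} {s} (inj₂ 2x≡2s+1) = ⊥-elim (even≢odd x s (trans 2x≡2s+1 (+-comm (2 * s) 1)))

parent-odd : ∀ {x s} → TreeEdge s (suc (2 * x)) → s ≡ x
parent-odd {x} {s} (inj₁ 2x+1≡2s) = ⊥-elim (even≢odd s x (sym 2x+1≡2s))
parent-odd {x} {s} (inj₂ 2x+1≡2s+1) =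
  sym (*-cancelˡ-≡ x s 2 (suc-injective (trans 2x+1≡2s+1 (+-comm (2 * s) 1))))

NbrsWithin : ℕ → ℕ → ℕ → ℕ → Set
NbrsWithin n v p q = ∀ s → Adj n v s → s ≡ p ⊎ s ≡ q

LowerHalf : ℕ → ℕ → Set
LowerHalf n v = AtLevel n v × v < 2 ^ n + 2 ^ (n ∸ 1)

UpperHalf : ℕ → ℕ → Set
UpperHalf n v = AtLevel n v × 2 ^ n + 2 ^ (n ∸ 1) ≤ v

-- A leaf v in the lower half of the bottom level has no twin below it, so its
-- neighbours are its parent p and q = v + 2^(n-1).
lowerLeaf-nbrs : ∀ n {v p q} → LowerHalf n v →
                 (∀ {s} → TreeEdge s v → s ≡ p) → v + 2 ^ (n ∸ 1) ≡ q → NbrsWithin n v p q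
lowerLeaf-nbrs n (lv , low) parent twin s adj with leaf-nbrs n lv adj
... | inj₁ s-parent        = inj₁ (parent s-parent)
... | inj₂ (_ , inj₁ s≡)  = inj₂ (trans s≡ twin)
... | inj₂ (ls , inj₂ v≡) =
  ⊥-elim (<⇒≱ low (subst (_ ≤_) (sym v≡) (+-monoˡ-≤ _ (proj₁ ls))))

-- A leaf v in the upper half of the bottom level has no twin above it, so its
-- neighbours are its parent p and the q with v = q + 2^(n-1).
upperLeaf-nbrs : ∀ k {v p q} → UpperHalf (suc k) v →
                 (∀ {s} → TreeEdge s v → s ≡ p) → v ≡ q + 2 ^ k → NbrsWithin (suc k) v p q
upperLeaf-nbrs k {v} {q = q} (lv , high) parent twin s adj with leaf-nbrs (suc k) lv adj
... | inj₁ s-parent        = inj₁ (parent s-parent)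
... | inj₂ (_ , inj₂ v≡)  = inj₂ (+-cancelʳ-≡ (2 ^ k) s q (trans (sym v≡) twin))
... | inj₂ (ls , inj₁ s≡) = ⊥-elim (<⇒≱ (proj₂ ls) beyond-top)
  where
  beyond-top : 2 ^ (suc k + 1) ≤ s
  beyond-top = begin
      2 ^ (suc k + 1)          ≡⟨ pow-suc (suc k) ⟩
      2 * (2 * 2 ^ k)          ≡⟨ four-quarters (2 ^ k) ⟩
      2 ^ suc k + 2 ^ k + 2 ^ k ≤⟨ +-monoˡ-≤ (2 ^ k) high ⟩
      v + 2 ^ k                ≡⟨ sym s≡ ⟩
      s                        ∎
    where open ≤-Reasoning

record TwinLeaves (n x x' a b a' b' : ℕ) : Set where
  field
    a≢b       : a ≢ b
    a-parent  : Adj n a x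
    b-parent  : Adj n b x
    a'-vertex : Vertex n a'
    b'-vertex : Vertex n b'
    a-nbrs    : NbrsWithin n a x a'
    b-nbrs    : NbrsWithin n b x b'
    a'-nbrs   : NbrsWithin n a' x' a
    b'-nbrs   : NbrsWithin n b' x' b

dominator-forced : ∀ n {S v p q} → TotalDominating n S → Vertex n v →
                   NbrsWithin n v p q → p ∉ S → q ∈ S
dominator-forced n {v = v} td v-vertex nbrs p∉S with td v v-vertex
... | s , s∈S , adj with nbrs s adj
... | inj₁ refl = ⊥-elim (p∉S s∈S)
... | inj₂ refl = s∈S

sole-nbr-in : ∀ n {S v p q s} → NbrsWithin n v p q → q ∉ S → s ∈ S → Adj n v s → s ≡ p
sole-nbr-in n {s = s} nbrs q∉S s∈S adj with nbrs s adj
... | inj₁ s≡p = s≡p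
... | inj₂ refl = ⊥-elim (q∉S s∈S)

-- Location: if no leaf of a twin configuration were in S, the leaves a and b
-- would both have exactly {x} ∩ S as S-neighbourhood.
some-leaf-in : ∀ {n S x x' a b a' b'} → Locating n S → TwinLeaves n x x' a b a' b' →
               a ∈ S ⊎ b ∈ S ⊎ a' ∈ S ⊎ b' ∈ S
some-leaf-in {n} {S} {a = a} {b} {a'} {b'} loc tw with a ∈? S | b ∈? S | a' ∈? S | b' ∈? S
... | yes a∈S | _       | _        | _        = inj₁ a∈S
... | no _    | yes b∈S | _        | _        = inj₂ (inj₁ b∈S)
... | no _    | no _    | yes a'∈S | _        = inj₂ (inj₂ (inj₁ a'∈S))
... | no _    | no _    | no _     | yes b'∈S = inj₂ (inj₂ (inj₂ b'∈S))
... | no a∉S  | no b∉S  | no a'∉S  | no b'∉S  =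
  ⊥-elim (loc a b (proj₁ a-parent) (proj₁ b-parent) a≢b a∉S b∉S same-trace)
  where
  open TwinLeaves tw
  same-trace : ∀ s → s ∈ S → (Adj n a s ⇔ Adj n b s)
  same-trace s s∈S = mk⇔
    (λ adj → subst (Adj n b) (sym (sole-nbr-in n a-nbrs a'∉S s∈S adj)) b-parent)
    (λ adj → subst (Adj n a) (sym (sole-nbr-in n b-nbrs b'∉S s∈S adj)) a-parent)

module _ {n : ℕ} {S : List ℕ} {x x' a b a' b' : ℕ}
         (td : TotalDominating n S) (loc : Locating n S) (tw : TwinLeaves n x x' a b a' b') where

  open TwinLeaves tw

  private
    I : ℕ → ℕ
    I = indicator S

    tally : ∀ {p₁ p₂ p₃ p₄ p₅ p₆} →
            p₁ ≤ I x → p₂ ≤ I a → p₃ ≤ I b → p₄ ≤ I x' → p₅ ≤ I a' → p₆ ≤ I b' →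
            (p₁ + (p₂ + p₃)) + (p₄ + (p₅ + p₆)) ≤ (I x + (I a + I b)) + (I x' + (I a' + I b'))
    tally h₁ h₂ h₃ h₄ h₅ h₆ = +-mono-≤ (+-mono-≤ h₁ (+-mono-≤ h₂ h₃)) (+-mono-≤ h₄ (+-mono-≤ h₅ h₆))

    via-a : x ∉ S → a' ∈ S
    via-a = dominator-forced n td (proj₁ a-parent) a-nbrs
    via-b : x ∉ S → b' ∈ S
    via-b = dominator-forced n td (proj₁ b-parent) b-nbrs
    via-a' : x' ∉ S → a ∈ S
    via-a' = dominator-forced n td a'-vertex a'-nbrs
    via-b' : x' ∉ S → b ∈ S
    via-b' = dominator-forced n td b'-vertex b'-nbrs

  both-parents : x ∈ S → x' ∈ S → a ∈ S ⊎ b ∈ S ⊎ a' ∈ S ⊎ b' ∈ S →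
                 3 ≤ (I x + (I a + I b)) + (I x' + (I a' + I b'))
  both-parents x∈S x'∈S (inj₁ a∈S) =
    tally (indicator-∈ x∈S) (indicator-∈ a∈S) z≤n (indicator-∈ x'∈S) z≤n z≤n
  both-parents x∈S x'∈S (inj₂ (inj₁ b∈S)) =
    tally (indicator-∈ x∈S) z≤n (indicator-∈ b∈S) (indicator-∈ x'∈S) z≤n z≤n
  both-parents x∈S x'∈S (inj₂ (inj₂ (inj₁ a'∈S))) =
    tally (indicator-∈ x∈S) z≤n z≤n (indicator-∈ x'∈S) (indicator-∈ a'∈S) z≤n
  both-parents x∈S x'∈S (inj₂ (inj₂ (inj₂ b'∈S))) =
    tally (indicator-∈ x∈S) z≤n z≤n (indicator-∈ x'∈S) z≤n (indicator-∈ b'∈S)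

  -- A missing parent forces the twins of its children into S.
  by-parents : Dec (x ∈ S) → Dec (x' ∈ S) → 3 ≤ (I x + (I a + I b)) + (I x' + (I a' + I b'))
  by-parents (yes x∈S) (yes x'∈S) = both-parents x∈S x'∈S (some-leaf-in loc tw)
  by-parents (yes x∈S) (no x'∉S)  =
    tally (indicator-∈ x∈S) (indicator-∈ (via-a' x'∉S)) (indicator-∈ (via-b' x'∉S)) z≤n z≤n z≤n
  by-parents (no x∉S)  (yes x'∈S) =
    tally z≤n z≤n z≤n (indicator-∈ x'∈S) (indicator-∈ (via-a x∉S)) (indicator-∈ (via-b x∉S))
  by-parents (no x∉S)  (no x'∉S)  =
    tally z≤n (indicator-∈ (via-a' x'∉S)) z≤n z≤n (indicator-∈ (via-a x∉S)) (indicator-∈ (via-b x∉S))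

  twinLeaves-count : 3 ≤ (I x + (I a + I b)) + (I x' + (I a' + I b'))
  twinLeaves-count = by-parents (x ∈? S) (x' ∈? S)

children-within : ∀ {L U y} → L ≤ y → y < U →
                  (2 * L ≤ 2 * y × 2 * y < 2 * U) × (2 * L ≤ suc (2 * y) × suc (2 * y) < 2 * U)
children-within {L} {U} {y} L≤y y<U =
  (lower , <-trans (n<1+n (2 * y)) upper) , (≤-trans lower (n≤1+n (2 * y)) , upper)
  where
  lower : 2 * L ≤ 2 * y
  lower = *-monoʳ-≤ 2 L≤y
  upper : suc (suc (2 * y)) ≤ 2 * U
  upper = subst (_≤ 2 * U) (*-suc 2 y) (*-monoʳ-≤ 2 y<U)

middle-of-level : ∀ m → 2 * (2 * 2 ^ m + 2 ^ m) ≡ 2 ^ suc (suc m) + 2 ^ suc m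
middle-of-level m = *-distribˡ-+ 2 (2 * 2 ^ m) (2 ^ m)

end-of-level : ∀ m → 2 * (2 * 2 ^ m + 2 ^ m + 2 ^ m) ≡ 2 ^ (suc (suc m) + 1)
end-of-level m = trans (cong (2 *_) (sym (four-quarters (2 ^ m)))) (sym (pow-suc (suc (suc m))))

lower-children : ∀ m {y} → 2 * 2 ^ m ≤ y → y < 2 * 2 ^ m + 2 ^ m →
                 LowerHalf (suc (suc m)) (2 * y) × LowerHalf (suc (suc m)) (suc (2 * y))
lower-children m y-lower y-upper with children-within y-lower y-upper
... | (lo₀ , hi₀) , (lo₁ , hi₁) = in-lower lo₀ hi₀ , in-lower lo₁ hi₁
  where
  middle≤end : 2 * (2 * 2 ^ m + 2 ^ m) ≤ 2 ^ (suc (suc m) + 1)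
  middle≤end = subst (2 * (2 * 2 ^ m + 2 ^ m) ≤_) (end-of-level m) (*-monoʳ-≤ 2 (m≤m+n (2 * 2 ^ m + 2 ^ m) (2 ^ m)))
  in-lower : ∀ {c} → 2 ^ suc (suc m) ≤ c → c < 2 * (2 * 2 ^ m + 2 ^ m) → LowerHalf (suc (suc m)) c
  in-lower {c} lo hi = (lo , <-≤-trans hi middle≤end) , subst (c <_) (middle-of-level m) hi

upper-children : ∀ m {y} → 2 * 2 ^ m + 2 ^ m ≤ y → y < 2 * 2 ^ m + 2 ^ m + 2 ^ m →
                 UpperHalf (suc (suc m)) (2 * y) × UpperHalf (suc (suc m)) (suc (2 * y))
upper-children m y-lower y-upper with children-within y-lower y-upper
... | (lo₀ , hi₀) , (lo₁ , hi₁) = in-upper lo₀ hi₀ , in-upper lo₁ hi₁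
  where
  in-upper : ∀ {c} → 2 * (2 * 2 ^ m + 2 ^ m) ≤ c → c < 2 * (2 * 2 ^ m + 2 ^ m + 2 ^ m) →
             UpperHalf (suc (suc m)) c
  in-upper {c} lo hi = (≤-trans (m≤m+n _ (2 ^ suc m)) middle≤c , subst (c <_) (end-of-level m) hi)
                     , middle≤c
    where
    middle≤c : 2 ^ suc (suc m) + 2 ^ suc m ≤ c
    middle≤c = subst (_≤ c) (middle-of-level m) lo

twinLeaves-at : ∀ m x → 2 * 2 ^ m ≤ x → x < 2 * 2 ^ m + 2 ^ m →
  TwinLeaves (suc (suc m)) x (x + 2 ^ m) (2 * x) (suc (2 * x))
             (2 * (x + 2 ^ m)) (suc (2 * (x + 2 ^ m)))
twinLeaves-at m x x-lower x-upper = record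
  { a≢b       = even≢odd x x
  ; a-parent  = level⇒vertex n (proj₁ a-half) , x-vertex , inj₂ (inj₁ (inj₁ refl))
  ; b-parent  = level⇒vertex n (proj₁ b-half) , x-vertex , inj₂ (inj₁ (inj₂ (+-comm 1 (2 * x))))
  ; a'-vertex = level⇒vertex n (proj₁ a'-half)
  ; b'-vertex = level⇒vertex n (proj₁ b'-half)
  ; a-nbrs    = lowerLeaf-nbrs n a-half parent-even (sym twin-even)
  ; b-nbrs    = lowerLeaf-nbrs n b-half parent-odd (cong suc (sym twin-even))
  ; a'-nbrs   = upperLeaf-nbrs (suc m) a'-half parent-even twin-even
  ; b'-nbrs   = upperLeaf-nbrs (suc m) b'-half parent-odd (cong suc twin-even)
  }
  where
  n h x' : ℕ
  n = suc (suc m)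
  h = 2 ^ m
  x' = x + h
  -- The children of x' are those of x shifted by 2^(n-1) = 2h.
  twin-even : 2 * x' ≡ 2 * x + 2 * h
  twin-even = *-distribˡ-+ 2 x h
  a-half : LowerHalf n (2 * x)
  a-half = proj₁ (lower-children m x-lower x-upper)
  b-half : LowerHalf n (suc (2 * x))
  b-half = proj₂ (lower-children m x-lower x-upper)
  a'-half : UpperHalf n (2 * x')
  a'-half = proj₁ (upper-children m (+-monoˡ-≤ h x-lower) (+-monoˡ-< h x-upper))
  b'-half : UpperHalf n (suc (2 * x'))
  b'-half = proj₂ (upper-children m (+-monoˡ-≤ h x-lower) (+-monoˡ-< h x-upper))
  x-vertex : Vertex n x
  x-vertex = ≤-trans (pow-pos (suc m)) x-lower
           , ≤-<-trans (m≤m+n x (x + 0)) (proj₂ (proj₁ a-half))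

-- In HT(m+2) the h = 2^m twin configurations partition the last two levels,
-- so a locating-total dominating set has at least 3h vertices there.
lastTwoLevels-lower : ∀ m S → TotalDominating (suc (suc m)) S → Locating (suc (suc m)) S →
                      2 ^ m * 3 ≤ countLastTwo (suc (suc m)) S
lastTwoLevels-lower m S td loc = begin
    h * 3                                        ≤⟨ sumRange-lower pair-count 3 (2 * h) h pair≥3 ⟩
    sumRange pair-count (2 * h) h                ≡⟨ sym (sumRange-fold (family I) (2 * h) h) ⟩
    sumRange (family I) (2 * h) (2 * h)          ≡⟨ sym (sumRange-families I (2 * h)) ⟩
    sumRange I (2 * h) (2 * h + 2 * (2 * h))     ≤⟨ sumRange-indicator≤ S (2 * h) (2 * h + 2 * (2 * h)) ⟩
    countLastTwo (suc (suc m)) S                 ∎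
  where
  open ≤-Reasoning
  h : ℕ
  h = 2 ^ m
  I : ℕ → ℕ
  I = indicator S
  pair-count : ℕ → ℕ
  pair-count x = family I x + family I (x + h)
  pair≥3 : ∀ x → 2 * h ≤ x → x < 2 * h + h → 3 ≤ pair-count x
  pair≥3 x x-lower x-upper = twinLeaves-count td loc (twinLeaves-at m x x-lower x-upper)

-- HT(1) consists of levels 0 and 1 only; a total dominating set contains a
-- dominator s of the root and a dominator t of s, and s ≠ t.
HT1-lower : ∀ S → TotalDominating 1 S → 2 ≤ countLastTwo 1 S
HT1-lower S td with td 1 (root-vertex 1)
... | s , s∈S , root-s with td s (proj₁ (proj₂ root-s))
... | t , t∈S , s-t = unique⊆⇒length≤ pair-unique pair⊆
  where
  s≢t : s ≢ t
  s≢t refl = adj-irreflexive {1} s-t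
  pair-unique : Unique (s ∷ t ∷ [])
  pair-unique = (s≢t All.∷ All.[]) AllPairs.∷ (All.[] AllPairs.∷ AllPairs.[])
  pair⊆ : s ∷ t ∷ [] ⊆ filter (1 ≤?_) S
  pair⊆ (here refl)         = ∈-filter⁺ (1 ≤?_) s∈S (proj₁ (proj₁ (proj₂ root-s)))
  pair⊆ (there (here refl)) = ∈-filter⁺ (1 ≤?_) t∈S (proj₁ (proj₁ (proj₂ s-t)))

ltds-lastTwoLevels : ∀ n → 1 ≤ n → ∀ S → IsLTDS n S → 3 * 2 ^ n ≤ 4 * countLastTwo n S
ltds-lastTwoLevels zero          () S
ltds-lastTwoLevels (suc zero) _ S (_ , td , _) =
  ≤-trans (m≤m+n 6 2) (*-monoʳ-≤ 4 (HT1-lower S td))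
ltds-lastTwoLevels (suc (suc m)) _ S (_ , td , loc) = begin
    3 * 2 ^ suc (suc m)            ≡⟨ twelve-quarters (2 ^ m) ⟩
    4 * (2 ^ m * 3)                ≤⟨ *-monoʳ-≤ 4 (lastTwoLevels-lower m S td loc) ⟩
    4 * countLastTwo (suc (suc m)) S ∎
  where
  open ≤-Reasoning
  twelve-quarters : ∀ h → 3 * (2 * (2 * h)) ≡ 4 * (h * 3)
  twelve-quarters = solve-∀

lemma7 : (n : ℕ) → 1 ≤ n → (S : List ℕ) → IsMinLTDS n S →
         3 * 2 ^ n ≤ 4 * countLastTwo n S
lemma7 n 1≤n S (isLTDS , _) = ltds-lastTwoLevels n 1≤n S isLTDS
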